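{- Let $n$ be a power of $2$ such that every digit of $n$ in base $3$ is equal to $0$ or $1$. Then $\binom{2n}{n}$ is not a practical number.
   Context: A practical number is a positive integer $m$ such that every positive integer less than $m$ can be written as a sum of distinct divisors of $m$. -}

module Defs where

open import Data.Nat using (ℕ; zero; suc; _+_; _*_; _^_; _≤_; _<_)
open import Data.Nat.DivMod using (_/_; _%_)
open import Data.Nat.Divisibility using (_∣_)
open import Data.List using (List)
open import Data.Nat.ListAction using (sum)
open import Relation.Binary.PropositionalEquality using (_≡_)
open import Data.List.Relation.Unary.All using (All)
open import Data.List.Relation.Unary.Unique.Propositional using (Unique)
open import Data.Product using (Σ; _×_; ∃)

SumOfDistinctDivisors : ℕ → ℕ → Set
SumOfDistinctDivisors m k =
  Σ (List ℕ) λ ds → Unique ds × All (λ d → d ∣ m) ds × sum ds ≡ k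

Practical : ℕ → Set
Practical m = 0 < m × (∀ k → 0 < k → k < m → SumOfDistinctDivisors m k)

digit3 : ℕ → ℕ → ℕ
digit3 n zero = n % 3
digit3 n (suc i) = digit3 (n / 3) i

Digits3In01 : ℕ → Set
Digits3In01 n = ∀ i → digit3 n i ≤ 1

PowerOf2 : ℕ → Set
PowerOf2 n = ∃ λ k → n ≡ 2 ^ k

{-# OPTIONS --safe #-}
-- By Lucas's theorem modulo 3, C(2n, n) ≡ ∏ C(2 dᵢ, dᵢ) over the base-3 digits
-- dᵢ ∈ {0, 1} of n, and each factor is 1 or 2, so 3 ∤ C(2n, n). For n = 2ᵏ⁺¹,
-- symmetry and Pascal's rule give C(2n, n) = 2 C(2n − 1, n − 1), and Lucas's
-- theorem modulo 2 shows that C(2ᵏ⁺² − 1, 2ᵏ⁺¹ − 1) is odd, so 4 ∤ C(2n, n).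
-- Hence the only divisors of C(2n, n) below 5 are 1 and 2, and 4 < C(2n, n)
-- is not a sum of distinct divisors.
module Submission where

open import Defs
open import Data.Nat
open import Data.Nat.Properties
open import Data.Nat.DivMod
open import Algebra.Properties.CommutativeSemigroup +-commutativeSemigroup using (interchange)
open import Data.Nat.Divisibility
  using (_∣_; ∣-refl; >⇒∤; 0∣⇒≡0; *-cancelˡ-∣; m%n≡0⇒n∣m; n∣m⇒m%n≡0)
open import Data.Nat.Combinatorics
  using (_C_; nCn≡1; k>n⇒nCk≡0; nCk≡nC[n∸k]; nCk+nC[k+1]≡[n+1]C[k+1])
open import Data.Nat.Primality using (prime?; euclidsLemma)
open import Data.Nat.Induction using (<-rec)
open import Data.Nat.ListAction using (sum)
open import Data.Nat.Tactic.RingSolver using (solve-∀)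
open import Data.List using ([]; _∷_)
open import Data.List.Membership.Propositional using (_∈_)
open import Data.List.Relation.Unary.Any using (here; there)
open import Data.List.Relation.Unary.All as All using (All; []; _∷_)
open import Data.List.Relation.Unary.AllPairs using ([]; _∷_)
open import Data.List.Relation.Unary.Unique.Propositional using (Unique)
open import Data.Product using (_,_)
open import Data.Sum using ([_,_]′)
open import Function using (_∘_)
open import Induction.WellFounded using (WfRec)
open import Level using (0ℓ)
open import Relation.Binary using (Rel; Setoid)
open import Relation.Binary.Construct.On as On using ()
open import Relation.Binary.PropositionalEquality
open import Relation.Nullary using (¬_; yes; no; contradiction)
open import Relation.Nullary.Decidable using (from-yes)

0<nCk : ∀ {n k} → k ≤ n → 0 < n C k
0<nCk {k = zero} _ = z<s
0<nCk {suc n} {suc k} (s≤s k≤n) =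
  ≤-trans (0<nCk k≤n) (≤-trans (m≤m+n _ _) (≤-reflexive (nCk+nC[k+1]≡[n+1]C[k+1] n k)))

2≤nCk : ∀ {n k} → 0 < k → k < n → 2 ≤ n C k
2≤nCk {suc n} {suc k} _ (s≤s k<n) =
  ≤-trans (+-mono-≤ (0<nCk (<⇒≤ k<n)) (0<nCk k<n))
          (≤-reflexive (nCk+nC[k+1]≡[n+1]C[k+1] n k))

nC[n+i]≡0Ci : ∀ n i → n C (n + i) ≡ 0 C i
nC[n+i]≡0Ci n zero    = trans (cong (n C_) (+-identityʳ n)) (nCn≡1 n)
nC[n+i]≡0Ci n (suc i) = k>n⇒nCk≡0 (m<m+n n z<s)

m*2+1≡1+m+m : ∀ m → m * 2 + 1 ≡ suc m + m
m*2+1≡1+m+m = solve-∀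

2*[1+m]≡1+[m*2+1] : ∀ m → 2 * suc m ≡ suc (m * 2 + 1)
2*[1+m]≡1+[m*2+1] = solve-∀

n+n≡2*n : ∀ n → n + n ≡ 2 * n
n+n≡2*n = solve-∀

2*[ap+r]≡[2a]p+2r : ∀ a p r → 2 * (a * p + r) ≡ 2 * a * p + 2 * r
2*[ap+r]≡[2a]p+2r = solve-∀

[m*2+1]C[1+m]≡[m*2+1]Cm : ∀ m → (m * 2 + 1) C suc m ≡ (m * 2 + 1) C m
[m*2+1]C[1+m]≡[m*2+1]Cm m = begin
  (m * 2 + 1) C suc m                    ≡⟨ cong (_C suc m) (m*2+1≡1+m+m m) ⟩
  (suc m + m) C suc m                    ≡⟨ nCk≡nC[n∸k] (m≤m+n (suc m) m) ⟩
  (suc m + m) C ((suc m + m) ∸ suc m)    ≡⟨ cong₂ _C_ (sym (m*2+1≡1+m+m m)) (m+n∸m≡n (suc m) m) ⟩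
  (m * 2 + 1) C m                        ∎
  where open ≡-Reasoning

centralC-suc : ∀ m → (2 * suc m) C suc m ≡ 2 * ((m * 2 + 1) C m)
centralC-suc m = begin
  (2 * suc m) C suc m                        ≡⟨ cong (_C suc m) (2*[1+m]≡1+[m*2+1] m) ⟩
  suc (m * 2 + 1) C suc m                    ≡⟨ nCk+nC[k+1]≡[n+1]C[k+1] (m * 2 + 1) m ⟨
  (m * 2 + 1) C m + (m * 2 + 1) C suc m      ≡⟨ cong ((m * 2 + 1) C m +_) ([m*2+1]C[1+m]≡[m*2+1]Cm m) ⟩
  (m * 2 + 1) C m + (m * 2 + 1) C m          ≡⟨ n+n≡2*n ((m * 2 + 1) C m) ⟩
  2 * ((m * 2 + 1) C m)                      ∎
  where open ≡-Reasoning

-- shiftedC j n m is the coefficient of Xᵐ in Xʲ (1 + X)ⁿ.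
shiftedC : ℕ → ℕ → ℕ → ℕ
shiftedC zero    n m       = n C m
shiftedC (suc j) n zero    = 0
shiftedC (suc j) n (suc m) = shiftedC j n m

shiftedC-+ : ∀ j n i → shiftedC j n (j + i) ≡ n C i
shiftedC-+ zero    n i = refl
shiftedC-+ (suc j) n i = shiftedC-+ j n i

shiftedC-< : ∀ {j m} n → m < j → shiftedC j n m ≡ 0
shiftedC-< {suc j} {zero}  n _         = refl
shiftedC-< {suc j} {suc m} n (s≤s m<j) = shiftedC-< n m<j

shiftedC-pascal : ∀ j n m → shiftedC j n m + shiftedC j n (suc m) ≡ shiftedC j (suc n) (suc m)
shiftedC-pascal zero          n m       = nCk+nC[k+1]≡[n+1]C[k+1] n m
shiftedC-pascal (suc zero)    n zero    = refl
shiftedC-pascal (suc (suc j)) n zero    = refl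
shiftedC-pascal (suc j)       n (suc m) = shiftedC-pascal j n m

module Congruence (p : ℕ) .{{_ : NonZero p}} where

  infix 4 _≈_
  _≈_ : Rel ℕ 0ℓ
  x ≈ y = x % p ≡ y % p

  ≈-setoid : Setoid 0ℓ 0ℓ
  ≈-setoid = record { isEquivalence = On.isEquivalence (_% p) isEquivalence }

  +-cong : ∀ {a b c d} → a ≈ b → c ≈ d → a + c ≈ b + d
  +-cong {a} {b} {c} {d} a≈b c≈d = begin
    (a + c) % p              ≡⟨ %-distribˡ-+ a c p ⟩
    (a % p + c % p) % p      ≡⟨ cong₂ (λ x y → (x + y) % p) a≈b c≈d ⟩
    (b % p + d % p) % p      ≡⟨ %-distribˡ-+ b d p ⟨
    (b + d) % p              ∎
    where open ≡-Reasoning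

  ≡⇒≈ : ∀ {x y} → x ≡ y → x ≈ y
  ≡⇒≈ = cong (_% p)

  ∣⇒≈0 : ∀ {x} → p ∣ x → x ≈ 0
  ∣⇒≈0 {x} p∣x = trans (n∣m⇒m%n≡0 x p p∣x) (sym (m<n⇒m%n≡m (>-nonZero⁻¹ p)))

  ∣-resp-≈ : ∀ {x y} → x ≈ y → p ∣ x → p ∣ y
  ∣-resp-≈ {x} {y} x≈y p∣x = m%n≡0⇒n∣m y p (trans (sym x≈y) (n∣m⇒m%n≡0 x p p∣x))

-- (1 + X)ᵖ ≡ 1 + Xᵖ modulo p; this holds exactly when p is prime.
FrobeniusBinomial : ℕ → Set
FrobeniusBinomial p = ∀ s → 0 < s → s < p → p ∣ p C s

module Lucas (p : ℕ) .{{_ : NonZero p}} (frobenius : FrobeniusBinomial p) where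

  open Congruence p public
  open import Relation.Binary.Reasoning.Setoid ≈-setoid

  0<p : 0 < p
  0<p = >-nonZero⁻¹ p

  pCm≈0Cm+shiftedC : ∀ m → p C m ≈ 0 C m + shiftedC p 0 m
  pCm≈0Cm+shiftedC m with m <? p
  pCm≈0Cm+shiftedC zero      | yes _   = ≡⇒≈ (cong suc (sym (shiftedC-< 0 0<p)))
  pCm≈0Cm+shiftedC m@(suc _) | yes m<p = begin
    p C m                    ≈⟨ ∣⇒≈0 (frobenius m z<s m<p) ⟩
    0                        ≡⟨ shiftedC-< 0 m<p ⟨
    0 C m + shiftedC p 0 m   ∎
  pCm≈0Cm+shiftedC m         | no m≮p with m≤n⇒∃[o]m+o≡n (≮⇒≥ m≮p)
  ... | i , refl = begin
    p C (p + i)                          ≡⟨ nC[n+i]≡0Ci p i ⟩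
    0 C i                                ≡⟨ shiftedC-+ p 0 i ⟨
    shiftedC p 0 (p + i)                 ≡⟨ cong (_+ shiftedC p 0 (p + i)) (k>n⇒nCk≡0 (≤-trans 0<p (m≤m+n p i))) ⟨
    0 C (p + i) + shiftedC p 0 (p + i)   ∎

  -- Coefficients of (1 + X)ⁿ⁺ᵖ ≡ (1 + X)ⁿ (1 + Xᵖ).
  [n+p]Cm≈nCm+shiftedC : ∀ n m → (n + p) C m ≈ n C m + shiftedC p n m
  [n+p]Cm≈nCm+shiftedC zero    m    = pCm≈0Cm+shiftedC m
  [n+p]Cm≈nCm+shiftedC (suc n) zero = ≡⇒≈ (cong suc (sym (shiftedC-< (suc n) 0<p)))
  [n+p]Cm≈nCm+shiftedC (suc n) (suc m) = begin
    suc (n + p) C suc m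
      ≡⟨ nCk+nC[k+1]≡[n+1]C[k+1] (n + p) m ⟨
    (n + p) C m + (n + p) C suc m
      ≈⟨ +-cong ([n+p]Cm≈nCm+shiftedC n m) ([n+p]Cm≈nCm+shiftedC n (suc m)) ⟩
    (n C m + shiftedC p n m) + (n C suc m + shiftedC p n (suc m))
      ≡⟨ interchange (n C m) (shiftedC p n m) (n C suc m) (shiftedC p n (suc m)) ⟩
    (n C m + n C suc m) + (shiftedC p n m + shiftedC p n (suc m))
      ≡⟨ cong₂ _+_ (nCk+nC[k+1]≡[n+1]C[k+1] n m) (shiftedC-pascal p n m) ⟩
    suc n C suc m + shiftedC p (suc n) (suc m)
      ∎

  [[1+a]p+r]Cm≈[ap+r]Cm+shiftedC : ∀ a r m →
    (suc a * p + r) C m ≈ (a * p + r) C m + shiftedC p (a * p + r) m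
  [[1+a]p+r]Cm≈[ap+r]Cm+shiftedC a r m = begin
    (suc a * p + r) C m                             ≡⟨ cong (_C m) (+-assoc p (a * p) r) ⟩
    (p + (a * p + r)) C m                           ≡⟨ cong (_C m) (+-comm p (a * p + r)) ⟩
    (a * p + r + p) C m                             ≈⟨ [n+p]Cm≈nCm+shiftedC (a * p + r) m ⟩
    (a * p + r) C m + shiftedC p (a * p + r) m      ∎

  lucas : ∀ a b {r s} → r < p → s < p → (a * p + r) C (b * p + s) ≈ (a C b) * (r C s)
  lucas zero    zero    {r} {s} _   _   = ≡⇒≈ (sym (*-identityˡ (r C s)))
  lucas zero    (suc b) {r} {s} r<p _   =
    ≡⇒≈ (k>n⇒nCk≡0 (<-≤-trans r<p (≤-trans (m≤m+n p (b * p)) (m≤m+n (suc b * p) s))))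
  lucas (suc a) zero    {r} {s} r<p s<p = begin
    (suc a * p + r) C s                             ≈⟨ [[1+a]p+r]Cm≈[ap+r]Cm+shiftedC a r s ⟩
    (a * p + r) C s + shiftedC p (a * p + r) s      ≡⟨ cong ((a * p + r) C s +_) (shiftedC-< (a * p + r) s<p) ⟩
    (a * p + r) C s + 0                             ≡⟨ +-identityʳ _ ⟩
    (a * p + r) C s                                 ≈⟨ lucas a zero r<p s<p ⟩
    (suc a C 0) * (r C s)                           ∎
  lucas (suc a) (suc b) {r} {s} r<p s<p = begin
    (suc a * p + r) C (suc b * p + s)
      ≈⟨ [[1+a]p+r]Cm≈[ap+r]Cm+shiftedC a r (suc b * p + s) ⟩
    (a * p + r) C (suc b * p + s) + shiftedC p (a * p + r) (p + b * p + s)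
      ≡⟨ cong ((a * p + r) C (suc b * p + s) +_) shiftedC-[1+b]p+s ⟩
    (a * p + r) C (suc b * p + s) + (a * p + r) C (b * p + s)
      ≈⟨ +-cong (lucas a (suc b) r<p s<p) (lucas a b r<p s<p) ⟩
    (a C suc b) * (r C s) + (a C b) * (r C s)
      ≡⟨ *-distribʳ-+ (r C s) (a C suc b) (a C b) ⟨
    (a C suc b + a C b) * (r C s)
      ≡⟨ cong (_* (r C s)) (trans (+-comm (a C suc b) (a C b)) (nCk+nC[k+1]≡[n+1]C[k+1] a b)) ⟩
    (suc a C suc b) * (r C s)
      ∎
    where
    shiftedC-[1+b]p+s : shiftedC p (a * p + r) (p + b * p + s) ≡ (a * p + r) C (b * p + s)
    shiftedC-[1+b]p+s = trans (cong (shiftedC p (a * p + r)) (+-assoc p (b * p) s)) (shiftedC-+ p (a * p + r) (b * p + s))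

  centralC-lucas : ∀ a {r} → 2 * r < p →
    (2 * (a * p + r)) C (a * p + r) ≈ ((2 * a) C a) * ((2 * r) C r)
  centralC-lucas a {r} 2r<p = begin
    (2 * (a * p + r)) C (a * p + r)        ≡⟨ cong (_C (a * p + r)) (2*[ap+r]≡[2a]p+2r a p r) ⟩
    ((2 * a) * p + 2 * r) C (a * p + r)    ≈⟨ lucas (2 * a) a 2r<p (≤-<-trans (m≤n*m r 2) 2r<p) ⟩
    ((2 * a) C a) * ((2 * r) C r)          ∎

frobenius-2 : FrobeniusBinomial 2
frobenius-2 1             _ _ = ∣-refl
frobenius-2 (suc (suc _)) _ (s≤s (s≤s ()))

frobenius-3 : FrobeniusBinomial 3
frobenius-3 1                   _ _ = ∣-refl
frobenius-3 2                   _ _ = ∣-refl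
frobenius-3 (suc (suc (suc _))) _ (s≤s (s≤s (s≤s ())))

module Lucas₂ = Lucas 2 frobenius-2
module Lucas₃ = Lucas 3 frobenius-3

¬3∣[2r]Cr : ∀ {r} → r ≤ 1 → ¬ 3 ∣ (2 * r) C r
¬3∣[2r]Cr z≤n       = >⇒∤ (s≤s (s≤s z≤n))
¬3∣[2r]Cr (s≤s z≤n) = >⇒∤ (s≤s (s≤s (s≤s z≤n)))

¬3∣centralC : ∀ n → Digits3In01 n → ¬ 3 ∣ (2 * n) C n
¬3∣centralC = <-rec P step
  where
  P : ℕ → Set
  P n = Digits3In01 n → ¬ 3 ∣ (2 * n) C n

  step : ∀ n → WfRec _<_ P n → P n
  step zero        _   _      = >⇒∤ (s≤s (s≤s z≤n))
  step n@(suc _) rec digits 3∣ =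
    [ rec (m/n<m n 3 (s≤s (s≤s z≤n))) (digits ∘ suc) , ¬3∣[2r]Cr (digits 0) ]′
      (euclidsLemma _ _ (from-yes (prime? 3)) (Lucas₃.∣-resp-≈ (Lucas₃.centralC-lucas (n / 3) 2r<3) 3∣C-split))
    where
    3∣C-split : 3 ∣ (2 * (n / 3 * 3 + n % 3)) C (n / 3 * 3 + n % 3)
    3∣C-split = subst (λ m → 3 ∣ (2 * m) C m) (trans (m≡m%n+[m/n]*n n 3) (+-comm (n % 3) _)) 3∣
    2r<3 : 2 * (n % 3) < 3
    2r<3 = s≤s (*-monoʳ-≤ 2 (digits 0))

mersenne : ℕ → ℕ
mersenne zero    = 0
mersenne (suc k) = mersenne k * 2 + 1

2^k≡1+mersenne : ∀ k → 2 ^ k ≡ suc (mersenne k)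
2^k≡1+mersenne zero    = refl
2^k≡1+mersenne (suc k) = trans (cong (2 *_) (2^k≡1+mersenne k)) (2*[1+m]≡1+[m*2+1] (mersenne k))

¬2∣mersenneC : ∀ k → ¬ 2 ∣ mersenne (suc k) C mersenne k
¬2∣mersenneC zero    = >⇒∤ (s≤s (s≤s z≤n))
¬2∣mersenneC (suc k) 2∣ = ¬2∣mersenneC k (subst (2 ∣_) (*-identityʳ _) (Lucas₂.∣-resp-≈ lucas-2 2∣))
  where
  lucas-2 : mersenne (suc (suc k)) C mersenne (suc k) Lucas₂.≈ (mersenne (suc k) C mersenne k) * (1 C 1)
  lucas-2 = Lucas₂.lucas (mersenne (suc k)) (mersenne k) (s≤s (s≤s z≤n)) (s≤s (s≤s z≤n))

2<mersenneC : ∀ k → 2 < mersenne (suc (suc k)) C mersenne (suc k)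
2<mersenneC k = ≤∧≢⇒< (2≤nCk 0<M (≤-<-trans (m≤m*n M 2) (m<m+n (M * 2) z<s)))
                      (λ 2≡C → ¬2∣mersenneC (suc k) (subst (2 ∣_) 2≡C ∣-refl))
  where
  M : ℕ
  M = mersenne (suc k)
  0<M : 0 < M
  0<M = m≤n+m 1 (mersenne k * 2)

data OneOrTwo : ℕ → Set where
  one : OneOrTwo 1
  two : OneOrTwo 2

divisor≤4⇒OneOrTwo : ∀ {m d} → 0 < m → ¬ 3 ∣ m → ¬ 4 ∣ m → d ∣ m → d ≤ 4 → OneOrTwo d
divisor≤4⇒OneOrTwo {d = 0} 0<m _ _ 0∣m _ = contradiction (0∣⇒≡0 0∣m) (>⇒≢ 0<m)
divisor≤4⇒OneOrTwo {d = 1} _ _   _   _   _ = one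
divisor≤4⇒OneOrTwo {d = 2} _ _   _   _   _ = two
divisor≤4⇒OneOrTwo {d = 3} _ 3∤m _   3∣m _ = contradiction 3∣m 3∤m
divisor≤4⇒OneOrTwo {d = 4} _ _   4∤m 4∣m _ = contradiction 4∣m 4∤m
divisor≤4⇒OneOrTwo {d = suc (suc (suc (suc (suc _))))} _ _ _ _ (s≤s (s≤s (s≤s (s≤s ()))))

sum≤3 : ∀ {ds} → Unique ds → All OneOrTwo ds → sum ds ≤ 3
sum≤3 _                     []                    = z≤n
sum≤3 _                     (one ∷ [])            = s≤s z≤n
sum≤3 _                     (two ∷ [])            = s≤s (s≤s z≤n)
sum≤3 _                     (one ∷ two ∷ [])      = ≤-refl
sum≤3 _                     (two ∷ one ∷ [])      = ≤-refl
sum≤3 ((1≢1 ∷ _) ∷ _)       (one ∷ one ∷ _)       = contradiction refl 1≢1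
sum≤3 ((2≢2 ∷ _) ∷ _)       (two ∷ two ∷ _)       = contradiction refl 2≢2
sum≤3 ((_ ∷ 1≢1 ∷ _) ∷ _)   (one ∷ two ∷ one ∷ _) = contradiction refl 1≢1
sum≤3 (_ ∷ (2≢2 ∷ _) ∷ _)   (one ∷ two ∷ two ∷ _) = contradiction refl 2≢2
sum≤3 (_ ∷ (1≢1 ∷ _) ∷ _)   (two ∷ one ∷ one ∷ _) = contradiction refl 1≢1
sum≤3 ((_ ∷ 2≢2 ∷ _) ∷ _)   (two ∷ one ∷ two ∷ _) = contradiction refl 2≢2

∈⇒≤sum : ∀ {n ns} → n ∈ ns → n ≤ sum ns
∈⇒≤sum {ns = m ∷ ms} (here refl)  = m≤m+n m (sum ms)
∈⇒≤sum {ns = m ∷ ms} (there n∈ms) = ≤-trans (∈⇒≤sum n∈ms) (m≤n+m (sum ms) m)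

¬SumOfDistinctDivisors-4 : ∀ {m} → 0 < m → ¬ 3 ∣ m → ¬ 4 ∣ m → ¬ SumOfDistinctDivisors m 4
¬SumOfDistinctDivisors-4 0<m 3∤m 4∤m (ds , unique , divisors , sum≡4) =
  1+n≰n (subst (_≤ 3) sum≡4 (sum≤3 unique (All.tabulate oneOrTwo)))
  where
  oneOrTwo : ∀ {d} → d ∈ ds → OneOrTwo d
  oneOrTwo d∈ds = divisor≤4⇒OneOrTwo 0<m 3∤m 4∤m (All.lookup divisors d∈ds) (subst (_ ≤_) sum≡4 (∈⇒≤sum d∈ds))

3∤∧4∤⇒¬Practical : ∀ {m} → ¬ 3 ∣ m → ¬ 4 ∣ m → 4 < m → ¬ Practical m
3∤∧4∤⇒¬Practical 3∤m 4∤m 4<m (0<m , sums) = ¬SumOfDistinctDivisors-4 0<m 3∤m 4∤m (sums 4 z<s 4<m)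

proposition2p9 : (n : ℕ) → 2 ≤ n → PowerOf2 n → Digits3In01 n → ¬ Practical ((2 * n) C n)
proposition2p9 _ 2≤1 (zero , refl) _ = contradiction 2≤1 1+n≰n
proposition2p9 n _ (suc k , refl) digits =
  3∤∧4∤⇒¬Practical (¬3∣centralC n digits)
                   (4∤2o ∘ subst (4 ∣_) centralC≡2o)
                   (subst (4 <_) (sym centralC≡2o) (*-monoʳ-< 2 (2<mersenneC k)))
  where
  o : ℕ
  o = mersenne (suc (suc k)) C mersenne (suc k)

  centralC≡2o : (2 * n) C n ≡ 2 * o
  centralC≡2o = trans (cong (λ x → (2 * x) C x) (2^k≡1+mersenne (suc k)))
                      (centralC-suc (mersenne (suc k)))

  4∤2o : ¬ 4 ∣ 2 * o
  4∤2o = ¬2∣mersenneC (suc k) ∘ *-cancelˡ-∣ 2
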